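{- Let $q=p^n$, $p$ prime, and let $\mathcal A$ be a proper subset of the points of a projective plane $\Pi_q$ of order $q$ such that for every point $R\in\mathcal A$ there exist integers $0\le m_R,t_R\le p-1$ such that at most one line through $R$ meets $\mathcal A$ in a number of points congruent to $t_R\pmod p$ and all other lines through $R$ meet $\mathcal A$ in a number of points congruent to $m_R\pmod p$. Call $R\in\mathcal A$ regular if exactly one line through $R$ meets $\mathcal A$ in $t_R\pmod p$ points and the other $q$ lines through $R$ meet $\mathcal A$ in $m_R\pmod p$ points (so $t_R\ne m_R$), and irregular otherwise. Then for every regular point $Q\in\mathcal A$ we have $t_Q\equiv|\mathcal A|\pmod p$, and for every irregular point $Q\in\mathcal A$ we have $m_Q\equiv|\mathcal A|\pmod p$. -}

module Defs where

open import Data.Nat using (ℕ; zero; suc; _+_; _<_; _%_; NonZero)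
open import Data.Fin using (Fin)
import Data.Fin as F
open import Data.Bool using (Bool; true; false; T; _∧_; if_then_else_)
open import Data.Product using (Σ; ∃; ∃-syntax; _×_; _,_)
open import Relation.Binary.PropositionalEquality using (_≡_; _≢_)
open import Relation.Nullary using (¬_)

countFin : (n : ℕ) → (Fin n → Bool) → ℕ
countFin zero    f = 0
countFin (suc n) f = (if f F.zero then 1 else 0) + countFin n (λ i → f (F.suc i))

record ProjectivePlane (q : ℕ) : Set where
  field
    nPoints : ℕ
    nLines  : ℕ
    _I_     : Fin nPoints → Fin nLines → Bool
    joinUnique : ∀ P Q → P ≢ Q →
      ∃[ ℓ ] (T (P I ℓ) × T (Q I ℓ) × (∀ ℓ′ → T (P I ℓ′) → T (Q I ℓ′) → ℓ′ ≡ ℓ))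
    meetUnique : ∀ ℓ m → ℓ ≢ m →
      ∃[ P ] (T (P I ℓ) × T (P I m) × (∀ P′ → T (P′ I ℓ) → T (P′ I m) → P′ ≡ P))
    quadrangle : ∃[ A ] ∃[ B ] ∃[ C ] ∃[ D ]
      ((∀ ℓ → ¬ (T (A I ℓ) × T (B I ℓ) × T (C I ℓ))) ×
       (∀ ℓ → ¬ (T (A I ℓ) × T (B I ℓ) × T (D I ℓ))) ×
       (∀ ℓ → ¬ (T (A I ℓ) × T (C I ℓ) × T (D I ℓ))) ×
       (∀ ℓ → ¬ (T (B I ℓ) × T (C I ℓ) × T (D I ℓ))))
    lineSize : ∀ ℓ → countFin nPoints (λ P → P I ℓ) ≡ suc q

module _ {q : ℕ} (Π : ProjectivePlane q) where
  open ProjectivePlane Π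

  PointSet : Set
  PointSet = Fin nPoints → Bool

  size : PointSet → ℕ
  size A = countFin nPoints A

  meet : PointSet → Fin nLines → ℕ
  meet A ℓ = countFin nPoints (λ P → (P I ℓ) ∧ A P)

  -- The local configuration at a point R of A, with parameters m, t (0 ≤ m,t ≤ p-1):
  -- at most one line (namely ℓ₀, if t ≢ m) through R meets A in ≡ t (mod p) points,
  -- all other lines through R meet A in ≡ m (mod p) points.
  Config : (p : ℕ) .⦃ _ : NonZero p ⦄ → PointSet → Fin nPoints → (m t : ℕ) → Fin nLines → Set
  Config p A R m t ℓ₀ =
    m < p × t < p × T (R I ℓ₀) × (meet A ℓ₀ % p ≡ t) ×
    (∀ ℓ → T (R I ℓ) → ℓ ≢ ℓ₀ → meet A ℓ % p ≡ m)

module Submission where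

-- Proof idea: double counting in the pencil of lines through Q.
-- For a point Q and a point set S of a projective plane of order q, count the
-- incident pairs (ℓ , P) with Q ∈ ℓ and P ∈ ℓ ∩ S.  A point P ≠ Q lies on exactly
-- one line with Q, while Q lies on all r_Q lines of its pencil, so
--     Σ_{ℓ ∋ Q} |ℓ ∩ S| + [Q ∈ S]  =  |S| + [Q ∈ S]·r_Q          (pencil identity).
-- For S a line missing Q this gives r_Q = q + 1; for S = A and Q ∈ A it gives
-- Σ_{ℓ ∋ Q} |ℓ ∩ A| = |A| + q.  Under the local configuration at Q the distinguished
-- line ℓ₀ contributes t and each of the other q lines contributes m modulo p, so the
-- same sum is ≡ t + q·m.  A projective plane has order q ≠ 1, so p divides q = pⁿ
-- and |A| ≡ t (mod p): for a regular point this is the first claim, for an irregular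
-- one (t = m) the second.

open import Defs
open import Data.Nat using (ℕ; zero; suc; _+_; _*_; _^_; _%_; _≤_; NonZero; z≤n; s≤s)
open import Data.Nat.Properties
  using (+-*-semiring; +-commutativeSemigroup; +-comm; *-identityˡ; *-identityʳ; +-suc; suc-injective)
open import Data.Nat.DivMod using (%-distribˡ-+; m<n⇒m%n≡m; [m+kn]%n≡m%n)
open import Data.Nat.Divisibility using (_∣_; divides; m∣m*n; ∣m⇒∣m*n)
open import Data.Nat.Primality using (Prime)
open import Data.Bool using (Bool; true; false; T; not; _∧_; if_then_else_)
open import Data.Bool.Properties using (T?; ∧-idem)
open import Data.Unit using (tt)
open import Data.Fin using (Fin)
open import Data.Fin.Properties using (_≟_)
open import Data.Product using (∃; ∃-syntax; _×_; _,_; proj₁; proj₂)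
open import Function using (_∘_)
open import Relation.Nullary using (¬_; yes; no; does; contradiction)
open import Relation.Binary.PropositionalEquality
  using (_≡_; _≢_; refl; sym; trans; cong; cong₂; subst; module ≡-Reasoning)
open import Algebra.Properties.Semiring.Sum +-*-semiring
  using (sum; sum-syntax; ∑-comm; sum-cong-≗; *-distribˡ-sum; *-distribʳ-sum)
open import Algebra.Properties.CommutativeSemigroup +-commutativeSemigroup
  using (x∙yz≈y∙xz; xy∙z≈zy∙x)

open ≡-Reasoning

χ : Bool → ℕ
χ b = if b then 1 else 0

χ-true : ∀ {b} → T b → χ b ≡ 1
χ-true {true} _ = refl

χ-false : ∀ {b} → ¬ T b → χ b ≡ 0
χ-false {true}  ¬b = contradiction tt ¬b
χ-false {false} _  = refl

-- The Boolean identity [a]·[b ∧ c] = [c]·[a ∧ b] that exchanges the order of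
-- summation in the double count.
χ-rearrange : ∀ a b c → χ a * χ (b ∧ c) ≡ χ c * χ (a ∧ b)
χ-rearrange false false false = refl
χ-rearrange false false true  = refl
χ-rearrange false true  false = refl
χ-rearrange false true  true  = refl
χ-rearrange true  false false = refl
χ-rearrange true  false true  = refl
χ-rearrange true  true  false = refl
χ-rearrange true  true  true  = refl

χ*-cong : ∀ b {x y} → (T b → x ≡ y) → χ b * x ≡ χ b * y
χ*-cong false eq = refl
χ*-cong true  {x} {y} eq rewrite *-identityˡ x | *-identityˡ y = eq tt

left : ∀ {u v} → T (u ∧ v) → T u
left {true} _ = tt

right : ∀ {u v} → T (u ∧ v) → T v
right {true} v = v

both : ∀ {u v} → T u → T v → T (u ∧ v)
both {true} _ v = v

not-T : ∀ {b} → T (not b) → ¬ T b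
not-T {false} _ ()

count≡sum : ∀ n (f : Fin n → Bool) → countFin n f ≡ ∑[ i < n ] χ (f i)
count≡sum zero    f = refl
count≡sum (suc n) f = cong (χ (f Fin.zero) +_) (count≡sum n (f ∘ Fin.suc))

omit : ∀ {n} → Fin n → (Fin n → ℕ) → Fin n → ℕ
omit a f i = if does (i ≟ a) then 0 else f i

sum-extract : ∀ {n} (f : Fin n → ℕ) a → sum f ≡ f a + sum (omit a f)
sum-extract f Fin.zero    = refl
sum-extract f (Fin.suc a) = begin
  f Fin.zero + sum (f ∘ Fin.suc)
    ≡⟨ cong (f Fin.zero +_) (sum-extract (f ∘ Fin.suc) a) ⟩
  f Fin.zero + (f (Fin.suc a) + sum (omit a (f ∘ Fin.suc)))
    ≡⟨ x∙yz≈y∙xz (f Fin.zero) (f (Fin.suc a)) (sum (omit a (f ∘ Fin.suc))) ⟩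
  f (Fin.suc a) + (f Fin.zero + sum (omit a (f ∘ Fin.suc))) ∎

module _ (p : ℕ) .⦃ _ : NonZero p ⦄ where

  %-cong-+ : ∀ {a a′ b b′} → a % p ≡ a′ % p → b % p ≡ b′ % p → (a + b) % p ≡ (a′ + b′) % p
  %-cong-+ {a} {a′} {b} {b′} ea eb = begin
    (a + b) % p              ≡⟨ %-distribˡ-+ a b p ⟩
    (a % p + b % p) % p      ≡⟨ cong₂ (λ x y → (x + y) % p) ea eb ⟩
    (a′ % p + b′ % p) % p    ≡⟨ %-distribˡ-+ a′ b′ p ⟨
    (a′ + b′) % p            ∎

  %-absorb : ∀ a {x} → p ∣ x → (a + x) % p ≡ a % p
  %-absorb a (divides k refl) = [m+kn]%n≡m%n a k p

  sum-cong-% : ∀ {n} (f g : Fin n → ℕ) → (∀ i → f i % p ≡ g i % p) → sum f % p ≡ sum g % p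
  sum-cong-% {zero}  f g eq = refl
  sum-cong-% {suc n} f g eq =
    %-cong-+ (eq Fin.zero) (sum-cong-% (f ∘ Fin.suc) (g ∘ Fin.suc) (eq ∘ Fin.suc))

  χ*-cong-% : ∀ b {x y} → (T b → x % p ≡ y % p) → (χ b * x) % p ≡ (χ b * y) % p
  χ*-cong-% false eq = refl
  χ*-cong-% true  {x} {y} eq rewrite *-identityˡ x | *-identityˡ y = eq tt

  ∣-power : ∀ n → p ^ n ≢ 1 → p ∣ p ^ n
  ∣-power zero    pⁿ≢1 = contradiction refl pⁿ≢1
  ∣-power (suc n) _    = m∣m*n (p ^ n)

count-cong : ∀ n {f g : Fin n → Bool} → (∀ i → f i ≡ g i) → countFin n f ≡ countFin n g
count-cong n {f} {g} f≗g =
  trans (count≡sum n f) (trans (sum-cong-≗ (cong χ ∘ f≗g)) (sym (count≡sum n g)))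

count-none : ∀ n (f : Fin n → Bool) → (∀ i → ¬ T (f i)) → countFin n f ≡ 0
count-none zero    f none = refl
count-none (suc n) f none rewrite χ-false (none Fin.zero) =
  count-none n (f ∘ Fin.suc) (none ∘ Fin.suc)

count-remove : ∀ n (f : Fin n → Bool) a → T (f a) →
  countFin n f ≡ suc (countFin n (λ i → f i ∧ not (does (i ≟ a))))
count-remove n f a fa = begin
  countFin n f                                ≡⟨ count≡sum n f ⟩
  sum (χ ∘ f)                                 ≡⟨ sum-extract (χ ∘ f) a ⟩
  χ (f a) + sum (omit a (χ ∘ f))              ≡⟨ cong₂ _+_ (χ-true fa) (sum-cong-≗ others) ⟩
  suc (sum (λ i → χ (f i ∧ not (does (i ≟ a))))) ≡⟨ cong suc (count≡sum n _) ⟨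
  suc (countFin n (λ i → f i ∧ not (does (i ≟ a)))) ∎
  where
  others : ∀ i → omit a (χ ∘ f) i ≡ χ (f i ∧ not (does (i ≟ a)))
  others i with does (i ≟ a) | f i
  ... | true  | true  = refl
  ... | true  | false = refl
  ... | false | true  = refl
  ... | false | false = refl

count-unique : ∀ n (f : Fin n → Bool) a → T (f a) → (∀ i → T (f i) → i ≡ a) → countFin n f ≡ 1
count-unique n f a fa unique =
  trans (count-remove n f a fa) (cong suc (count-none n _ not-other))
  where
  not-other : ∀ i → ¬ T (f i ∧ not (does (i ≟ a)))
  not-other i fi∧i≢a with i ≟ a | f i | unique i
  ... | yes _   | true | _ = fi∧i≢a
  ... | no  i≢a | true | u = i≢a (u tt)

count-three : ∀ n (f : Fin n → Bool) a b c → T (f a) → T (f b) → T (f c) →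
  a ≢ b → a ≢ c → b ≢ c → 3 ≤ countFin n f
count-three n f a b c fa fb fc a≢b a≢c b≢c =
  subst (3 ≤_) (sym count≡) (s≤s (s≤s (s≤s z≤n)))
  where
  keep : ∀ {x y} → x ≢ y → T (not (does (x ≟ y)))
  keep {x} {y} x≢y with x ≟ y
  ... | yes x≡y = x≢y x≡y
  ... | no  _   = tt
  g = λ i → f i ∧ not (does (i ≟ a))
  h = λ i → g i ∧ not (does (i ≟ b))
  count≡ : countFin n f ≡ suc (suc (suc (countFin n (λ i → h i ∧ not (does (i ≟ c))))))
  count≡ = trans (count-remove n f a fa)
    (cong suc (trans (count-remove n g b (both fb (keep (a≢b ∘ sym)))) (cong suc
      (count-remove n h c (both (both fc (keep (a≢c ∘ sym))) (keep (b≢c ∘ sym)))))))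

module _ {q : ℕ} (Π : ProjectivePlane q) where
  open ProjectivePlane Π

  linesThrough : Fin nPoints → ℕ
  linesThrough Q = countFin nLines (λ ℓ → Q I ℓ)

  linesJoining : Fin nPoints → Fin nPoints → ℕ
  linesJoining Q P = countFin nLines (λ ℓ → Q I ℓ ∧ P I ℓ)

  linesJoining-self : ∀ Q → linesJoining Q Q ≡ linesThrough Q
  linesJoining-self Q = count-cong nLines (λ ℓ → ∧-idem (Q I ℓ))

  linesJoining-distinct : ∀ {Q P} → P ≢ Q → linesJoining Q P ≡ 1
  linesJoining-distinct {Q} {P} P≢Q =
    let (ℓ , Q∈ℓ , P∈ℓ , unique) = joinUnique Q P (P≢Q ∘ sym)
    in count-unique nLines _ ℓ (both Q∈ℓ P∈ℓ) (λ ℓ′ Q∧P → unique ℓ′ (left Q∧P) (right Q∧P))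

  pencilSum : PointSet Π → Fin nPoints → ℕ
  pencilSum S Q = ∑[ ℓ < nLines ] (χ (Q I ℓ) * meet Π S ℓ)

  -- Double counting of the pairs (ℓ , P) with Q ∈ ℓ, P ∈ ℓ ∩ S.
  pencil-double-count : ∀ S Q → pencilSum S Q ≡ ∑[ P < nPoints ] (χ (S P) * linesJoining Q P)
  pencil-double-count S Q = begin
    ∑[ ℓ < nLines ] (χ (Q I ℓ) * meet Π S ℓ)
      ≡⟨ sum-cong-≗ (λ ℓ → cong (χ (Q I ℓ) *_) (count≡sum nPoints _)) ⟩
    ∑[ ℓ < nLines ] (χ (Q I ℓ) * ∑[ P < nPoints ] χ (P I ℓ ∧ S P))
      ≡⟨ sum-cong-≗ (λ ℓ → *-distribˡ-sum (χ (Q I ℓ)) (λ P → χ (P I ℓ ∧ S P))) ⟩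
    ∑[ ℓ < nLines ] ∑[ P < nPoints ] (χ (Q I ℓ) * χ (P I ℓ ∧ S P))
      ≡⟨ ∑-comm (λ ℓ P → χ (Q I ℓ) * χ (P I ℓ ∧ S P)) ⟩
    ∑[ P < nPoints ] ∑[ ℓ < nLines ] (χ (Q I ℓ) * χ (P I ℓ ∧ S P))
      ≡⟨ sum-cong-≗ (λ P → sum-cong-≗ (λ ℓ → χ-rearrange (Q I ℓ) (P I ℓ) (S P))) ⟩
    ∑[ P < nPoints ] ∑[ ℓ < nLines ] (χ (S P) * χ (Q I ℓ ∧ P I ℓ))
      ≡⟨ sum-cong-≗ (λ P → *-distribˡ-sum (χ (S P)) (λ ℓ → χ (Q I ℓ ∧ P I ℓ))) ⟨
    ∑[ P < nPoints ] (χ (S P) * ∑[ ℓ < nLines ] χ (Q I ℓ ∧ P I ℓ))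
      ≡⟨ sum-cong-≗ (λ P → cong (χ (S P) *_) (count≡sum nLines _)) ⟨
    ∑[ P < nPoints ] (χ (S P) * linesJoining Q P) ∎

  pencil-identity : ∀ S Q → pencilSum S Q + χ (S Q) ≡ size Π S + χ (S Q) * linesThrough Q
  pencil-identity S Q = begin
    pencilSum S Q + χ (S Q)
      ≡⟨ cong (_+ χ (S Q)) (trans (pencil-double-count S Q) (sum-extract weight Q)) ⟩
    χ (S Q) * linesJoining Q Q + sum (omit Q weight) + χ (S Q)
      ≡⟨ cong₂ (λ x y → χ (S Q) * x + y + χ (S Q)) (linesJoining-self Q) (sum-cong-≗ others) ⟩
    χ (S Q) * linesThrough Q + sum (omit Q (χ ∘ S)) + χ (S Q)
      ≡⟨ xy∙z≈zy∙x (χ (S Q) * linesThrough Q) (sum (omit Q (χ ∘ S))) (χ (S Q)) ⟩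
    χ (S Q) + sum (omit Q (χ ∘ S)) + χ (S Q) * linesThrough Q
      ≡⟨ cong (_+ χ (S Q) * linesThrough Q) (trans (count≡sum nPoints S) (sum-extract (χ ∘ S) Q)) ⟨
    size Π S + χ (S Q) * linesThrough Q ∎
    where
    weight : Fin nPoints → ℕ
    weight P = χ (S P) * linesJoining Q P
    others : ∀ P → omit Q weight P ≡ omit Q (χ ∘ S) P
    others P with P ≟ Q
    ... | yes _   = refl
    ... | no  P≢Q = trans (cong (χ (S P) *_) (linesJoining-distinct P≢Q)) (*-identityʳ (χ (S P)))

  -- Consequences of the axioms in presence of two distinct points.
  -- (The axioms alone admit a one-point model without lines.)

  module _ (P₀ Q₀ : Fin nPoints) (P₀≢Q₀ : P₀ ≢ Q₀) where

    lineThrough : ∀ X → ∃[ ℓ ] T (X I ℓ)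
    lineThrough X with X ≟ P₀
    ... | no X≢P₀ = let (ℓ , X∈ℓ , _) = joinUnique X P₀ X≢P₀ in ℓ , X∈ℓ
    ... | yes refl = let (ℓ , X∈ℓ , _) = joinUnique X Q₀ P₀≢Q₀ in ℓ , X∈ℓ

    lineJoining : ∀ X Y → ∃[ ℓ ] (T (X I ℓ) × T (Y I ℓ))
    lineJoining X Y with X ≟ Y
    ... | no X≢Y = let (ℓ , X∈ℓ , Y∈ℓ , _) = joinUnique X Y X≢Y in ℓ , X∈ℓ , Y∈ℓ
    ... | yes refl = let (ℓ , X∈ℓ) = lineThrough X in ℓ , X∈ℓ , X∈ℓ

    NonCollinear : Fin nPoints → Fin nPoints → Fin nPoints → Set
    NonCollinear X Y Z = ∀ ℓ → ¬ (T (X I ℓ) × T (Y I ℓ) × T (Z I ℓ))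

    distinct₁₂ : ∀ {X Y Z} → NonCollinear X Y Z → X ≢ Y
    distinct₁₂ {X} {_} {Z} nc refl = let (ℓ , X∈ℓ , Z∈ℓ) = lineJoining X Z in nc ℓ (X∈ℓ , X∈ℓ , Z∈ℓ)

    distinct₁₃ : ∀ {X Y Z} → NonCollinear X Y Z → X ≢ Z
    distinct₁₃ {X} {Y} nc refl = let (ℓ , X∈ℓ , Y∈ℓ) = lineJoining X Y in nc ℓ (X∈ℓ , Y∈ℓ , X∈ℓ)

    distinct₂₃ : ∀ {X Y Z} → NonCollinear X Y Z → Y ≢ Z
    distinct₂₃ {X} {Y} nc refl = let (ℓ , X∈ℓ , Y∈ℓ) = lineJoining X Y in nc ℓ (X∈ℓ , Y∈ℓ , Y∈ℓ)

    -- Every point misses some line: of the lines AB, CD, AC of the quadrangle,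
    -- a point on AB and AC is A, which is not on CD.
    lineAvoiding : ∀ Q → ∃[ m ] ¬ T (Q I m)
    lineAvoiding Q with quadrangle
    ... | (A , B , C , D , abc , _ , acd , _)
      with joinUnique A B (distinct₁₂ abc) | joinUnique C D (distinct₂₃ acd)
         | joinUnique A C (distinct₁₃ abc)
    ... | (ab , A∈ab , B∈ab , _) | (cd , C∈cd , D∈cd , _) | (ac , A∈ac , C∈ac , _)
      with T? (Q I ab) | T? (Q I cd) | T? (Q I ac)
    ... | no Q∉ab | _ | _ = ab , Q∉ab
    ... | yes _ | no Q∉cd | _ = cd , Q∉cd
    ... | yes _ | yes _ | no Q∉ac = ac , Q∉ac
    ... | yes Q∈ab | yes Q∈cd | yes Q∈ac =
      contradiction (subst (λ X → T (X I cd)) Q≡A Q∈cd , C∈cd , D∈cd) (acd cd)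
      where
      ab≢ac : ab ≢ ac
      ab≢ac refl = abc ab (A∈ab , B∈ab , C∈ac)
      Q≡A : Q ≡ A
      Q≡A = let (_ , _ , _ , unique) = meetUnique ab ac ab≢ac
            in trans (unique Q Q∈ab Q∈ac) (sym (unique A A∈ab A∈ac))

    -- Every point lies on q + 1 lines: the pencil identity for a line m missing Q,
    -- where each line through Q meets m exactly once.
    linesThrough≡ : ∀ Q → linesThrough Q ≡ suc q
    linesThrough≡ Q = begin
      linesThrough Q                  ≡⟨ count≡sum nLines (λ ℓ → Q I ℓ) ⟩
      ∑[ ℓ < nLines ] χ (Q I ℓ)       ≡⟨ sum-cong-≗ meets-once ⟨
      pencilSum S Q                   ≡⟨ identity ⟩
      size Π S                        ≡⟨ lineSize m ⟩
      suc q                           ∎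
      where
      m = proj₁ (lineAvoiding Q)
      Q∉m = proj₂ (lineAvoiding Q)
      S : PointSet Π
      S P = P I m
      meets-once : ∀ ℓ → χ (Q I ℓ) * meet Π S ℓ ≡ χ (Q I ℓ)
      meets-once ℓ = trans (χ*-cong (Q I ℓ) once) (*-identityʳ (χ (Q I ℓ)))
        where
        once : T (Q I ℓ) → meet Π S ℓ ≡ 1
        once Q∈ℓ = let (X , X∈ℓ , X∈m , unique) = meetUnique ℓ m (λ { refl → Q∉m Q∈ℓ })
                   in count-unique nPoints _ X (both X∈ℓ X∈m) (λ P P∈ℓ∩m → unique P (left P∈ℓ∩m) (right P∈ℓ∩m))
      identity : pencilSum S Q ≡ size Π S
      identity with pencil-identity S Q
      ... | eq rewrite χ-false Q∉m | +-comm (pencilSum S Q) 0 | +-comm (size Π S) 0 = eq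

    -- The order of a projective plane is not 1: the lines AB and CD meet in a
    -- point different from A and B, so AB carries at least three points.
    order≢1 : q ≢ 1
    order≢1 refl with quadrangle
    ... | (A , B , C , D , abc , _ , acd , bcd)
      with joinUnique A B (distinct₁₂ abc) | joinUnique C D (distinct₂₃ acd)
    ... | (ab , A∈ab , B∈ab , _) | (cd , C∈cd , D∈cd , _)
      with meetUnique ab cd (λ ab≡cd → abc ab (A∈ab , B∈ab , subst (λ k → T (C I k)) (sym ab≡cd) C∈cd))
    ... | (X , X∈ab , X∈cd , _) with X ≟ A | X ≟ B
    ... | yes refl | _ = acd cd (X∈cd , C∈cd , D∈cd)
    ... | no _ | yes refl = bcd cd (X∈cd , C∈cd , D∈cd)
    ... | no X≢A | no X≢B with lineSize ab | count-three nPoints (λ P → P I ab) A B X A∈ab B∈ab X∈ab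
                                               (distinct₁₂ abc) (X≢A ∘ sym) (X≢B ∘ sym)
    ... | size≡2 | 3≤size with subst (3 ≤_) size≡2 3≤size
    ... | s≤s (s≤s ())

  pencilSum-member : ∀ S Q → T (S Q) → linesThrough Q ≡ suc q → pencilSum S Q ≡ size Π S + q
  pencilSum-member S Q Q∈S r≡ = suc-injective (begin
    suc (pencilSum S Q)                   ≡⟨ +-comm 1 (pencilSum S Q) ⟩
    pencilSum S Q + 1                     ≡⟨ cong (pencilSum S Q +_) (χ-true Q∈S) ⟨
    pencilSum S Q + χ (S Q)               ≡⟨ pencil-identity S Q ⟩
    size Π S + χ (S Q) * linesThrough Q   ≡⟨ cong₂ (λ x r → size Π S + x * r) (χ-true Q∈S) r≡ ⟩
    size Π S + 1 * suc q                  ≡⟨ cong (size Π S +_) (*-identityˡ (suc q)) ⟩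
    size Π S + suc q                      ≡⟨ +-suc (size Π S) q ⟩
    suc (size Π S + q)                    ∎)

  -- Under the local configuration at Q, the line ℓ₀ contributes t and each of the
  -- other q lines through Q contributes m modulo p.
  pencilSum-config : ∀ p .⦃ _ : NonZero p ⦄ A {Q m t ℓ₀} → Config Π p A Q m t ℓ₀ →
    linesThrough Q ≡ suc q → pencilSum A Q % p ≡ (t + q * m) % p
  pencilSum-config p A {Q} {m} {t} {ℓ₀} (m<p , t<p , Q∈ℓ₀ , meet₀ , meet-other) r≡ = begin
    pencilSum A Q % p                        ≡⟨ cong (_% p) (sum-extract term ℓ₀) ⟩
    (term ℓ₀ + sum (omit ℓ₀ term)) % p       ≡⟨ %-cong-+ p distinguished others ⟩
    (t + sum (omit ℓ₀ pencil) * m) % p       ≡⟨ cong (λ k → (t + k * m) % p) others-count ⟩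
    (t + q * m) % p                          ∎
    where
    pencil : Fin nLines → ℕ
    pencil ℓ = χ (Q I ℓ)
    term : Fin nLines → ℕ
    term ℓ = χ (Q I ℓ) * meet Π A ℓ

    distinguished : term ℓ₀ % p ≡ t % p
    distinguished = begin
      term ℓ₀ % p          ≡⟨ cong (λ x → (x * meet Π A ℓ₀) % p) (χ-true Q∈ℓ₀) ⟩
      (1 * meet Π A ℓ₀) % p ≡⟨ cong (_% p) (*-identityˡ (meet Π A ℓ₀)) ⟩
      meet Π A ℓ₀ % p      ≡⟨ meet₀ ⟩
      t                    ≡⟨ m<n⇒m%n≡m t<p ⟨
      t % p                ∎

    termwise : ∀ ℓ → omit ℓ₀ term ℓ % p ≡ omit ℓ₀ (λ ℓ′ → pencil ℓ′ * m) ℓ % p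
    termwise ℓ with ℓ ≟ ℓ₀
    ... | yes _    = refl
    ... | no ℓ≢ℓ₀ =
      χ*-cong-% p (Q I ℓ) (λ Q∈ℓ → trans (meet-other ℓ Q∈ℓ ℓ≢ℓ₀) (sym (m<n⇒m%n≡m m<p)))

    omit-* : ∀ ℓ → omit ℓ₀ pencil ℓ * m ≡ omit ℓ₀ (λ ℓ′ → pencil ℓ′ * m) ℓ
    omit-* ℓ with does (ℓ ≟ ℓ₀)
    ... | true  = refl
    ... | false = refl

    others : sum (omit ℓ₀ term) % p ≡ (sum (omit ℓ₀ pencil) * m) % p
    others = trans (sum-cong-% p _ _ termwise)
      (cong (_% p) (sym (trans (*-distribʳ-sum m (omit ℓ₀ pencil)) (sum-cong-≗ omit-*))))

    others-count : sum (omit ℓ₀ pencil) ≡ q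
    others-count = suc-injective (begin
      suc (sum (omit ℓ₀ pencil))          ≡⟨ cong (_+ sum (omit ℓ₀ pencil)) (χ-true Q∈ℓ₀) ⟨
      pencil ℓ₀ + sum (omit ℓ₀ pencil)    ≡⟨ sum-extract pencil ℓ₀ ⟨
      sum pencil                          ≡⟨ count≡sum nLines (λ ℓ → Q I ℓ) ⟨
      linesThrough Q                      ≡⟨ r≡ ⟩
      suc q                               ∎)

-- Proposition 4.1: |A| ≡ t_Q (mod p) at every point Q of A, which is the claim
-- for regular points and, since then t_Q = m_Q, also for irregular ones.

proposition4p1 : (p n : ℕ) .⦃ _ : NonZero p ⦄ → Prime p → (Π : ProjectivePlane (p ^ n)) →
    (A : PointSet Π) →
    (∃[ P ] T (not (A P))) →
    (∀ R → T (A R) → ∃[ m ] ∃[ t ] ∃[ ℓ₀ ] Config Π p A R m t ℓ₀) →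
    ∀ Q m t ℓ₀ → T (A Q) → Config Π p A Q m t ℓ₀ →
      (t ≢ m → t ≡ size Π A % p) × (t ≡ m → m ≡ size Π A % p)
proposition4p1 p n _ Π A (P₀ , P₀∉A) _ Q m t ℓ₀ Q∈A config@(_ , t<p , _) =
  (λ _ → t≡|A|) , (λ t≡m → trans (sym t≡m) t≡|A|)
  where
  q = p ^ n
  P₀≢Q : P₀ ≢ Q
  P₀≢Q refl = not-T P₀∉A Q∈A
  r≡ = linesThrough≡ Π P₀ Q P₀≢Q Q
  p∣q = ∣-power p n (order≢1 Π P₀ Q P₀≢Q)
  t≡|A| : t ≡ size Π A % p
  t≡|A| = begin
    t                     ≡⟨ m<n⇒m%n≡m t<p ⟨
    t % p                 ≡⟨ %-absorb p t (∣m⇒∣m*n m p∣q) ⟨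
    (t + q * m) % p       ≡⟨ pencilSum-config Π p A config r≡ ⟨
    pencilSum Π A Q % p   ≡⟨ cong (_% p) (pencilSum-member Π A Q Q∈A r≡) ⟩
    (size Π A + q) % p    ≡⟨ %-absorb p (size Π A) p∣q ⟩
    size Π A % p          ∎
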